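{- Let $n$ and $d\le n$ be positive integers and let $\mathcal{G}_{\mathcal S}$ be the sphere graph defined in the context. If $u,v\in V(\mathcal{G}_{\mathcal S})$ satisfy $\mathrm{wt}(v)\le \mathrm{wt}(u)$, then $\deg(v)\ge\deg(u)$ in $\mathcal{G}_{\mathcal S}$.
   Context: $\mathrm{wt}(\cdot)$ denotes Hamming weight. The sphere graph $\mathcal{G}_{\mathcal S}$ has as vertices the binary vectors of length $n$ of Hamming weight between $1$ and $d'=d-1$, two of them adjacent iff their Hamming distance is between $1$ and $d'$. -}

module Defs where

open import Data.Bool using (Bool; true; false; _xor_; _∧_)
open import Data.Nat using (ℕ; zero; suc; _+_; _∸_; _≤_; _≤ᵇ_)
open import Data.Vec using (Vec; []; _∷_; zipWith)
open import Data.Product using (_×_)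
open import Data.List using (List; []; _∷_; map; _++_; filterᵇ; length)

wt : ∀ {n} → Vec Bool n → ℕ
wt [] = 0
wt (true ∷ xs) = suc (wt xs)
wt (false ∷ xs) = wt xs

dist : ∀ {n} → Vec Bool n → Vec Bool n → ℕ
dist u v = wt (zipWith _xor_ u v)

allVecs : (n : ℕ) → List (Vec Bool n)
allVecs zero = [] ∷ []
allVecs (suc n) = map (false ∷_) (allVecs n) ++ map (true ∷_) (allVecs n)

inRange : ℕ → ℕ → Bool
inRange d' k = (1 ≤ᵇ k) ∧ (k ≤ᵇ d')

IsVertex : (n d : ℕ) → Vec Bool n → Set
IsVertex n d v = 1 ≤ wt v × wt v ≤ d ∸ 1

deg : (n d : ℕ) → Vec Bool n → ℕ
deg n d v = length (filterᵇ (λ w → inRange (d ∸ 1) (wt w) ∧ inRange (d ∸ 1) (dist v w)) (allVecs n))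

{-# OPTIONS --safe #-}
-- The degree of u is the sum over all w ∈ {0,1}ⁿ of [1 ≤ wt w ≤ d'] [1 ≤ dist(u,w) ≤ d'].
-- Summing out one coordinate of w turns a function of (wt w, dist(u,w)) into another such
-- function, depending only on the corresponding bit of u; these operations commute, so the
-- sum depends on u only through wt u. It remains to compare u = 1r with 0r. Pairing
-- w = 0w' with 1w', the difference deg(0r) − deg(1r) is a sum of terms
-- (χ(a+1) − χ(a)) (χ(b+1) − χ(b)) with a = wt w', b = dist(r,w') and χ the indicator of
-- [1, d'], and such a term is negative only if {a, b} = {0, d'}, which wt r < d' rules out.
module Submission where

open import Defs
open import Data.Bool using (Bool; true; false; _∧_; T)
open import Data.Empty using (⊥-elim)
open import Data.List using (List; []; _∷_; map; _++_; filterᵇ; length)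
open import Data.List.Properties using (map-++; map-∘; map-cong)
open import Data.Nat using (ℕ; zero; suc; _+_; _∸_; _≤_; _<_; z≤n)
open import Data.Nat.ListAction using (sum)
open import Data.Nat.ListAction.Properties using (sum-++)
open import Data.Nat.Properties
open import Algebra.Properties.CommutativeSemigroup +-commutativeSemigroup using (interchange)
open import Data.Product using (_×_; _,_; ∃-syntax)
open import Data.Sum using (_⊎_; inj₁; inj₂)
open import Data.Vec using (Vec; []; _∷_)
open import Function using (_∘_)
open import Relation.Binary.PropositionalEquality

bit : Bool → ℕ
bit false = 0
bit true = 1

bit-mono : ∀ {p q} → (T p → T q) → bit p ≤ bit q
bit-mono {false} _ = z≤n
bit-mono {true} {true} _ = ≤-refl
bit-mono {true} {false} p⇒q = ⊥-elim (p⇒q _)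

bit-rearrangement-antitone : ∀ p₀ p₁ q₀ q₁ → (T p₁ → T p₀) → (T q₁ → T q₀) →
  bit (p₀ ∧ q₁) + bit (p₁ ∧ q₀) ≤ bit (p₀ ∧ q₀) + bit (p₁ ∧ q₁)
bit-rearrangement-antitone false false _ _ _ _ = ≤-refl
bit-rearrangement-antitone false true _ _ p₁⇒p₀ _ = ⊥-elim (p₁⇒p₀ _)
bit-rearrangement-antitone true false q₀ q₁ _ q₁⇒q₀ = +-monoˡ-≤ 0 (bit-mono q₁⇒q₀)
bit-rearrangement-antitone true true q₀ q₁ _ _ = ≤-reflexive (+-comm (bit q₁) (bit q₀))

bit-rearrangement : ∀ p₀ p₁ q₀ q₁ →
  (T p₁ → T p₀) × (T q₁ → T q₀) ⊎ (T p₀ → T p₁) × (T q₀ → T q₁) →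
  bit (p₀ ∧ q₁) + bit (p₁ ∧ q₀) ≤ bit (p₀ ∧ q₀) + bit (p₁ ∧ q₁)
bit-rearrangement p₀ p₁ q₀ q₁ (inj₁ (p↓ , q↓)) = bit-rearrangement-antitone p₀ p₁ q₀ q₁ p↓ q↓
bit-rearrangement p₀ p₁ q₀ q₁ (inj₂ (p↑ , q↑)) =
  subst₂ _≤_ (+-comm (bit (p₁ ∧ q₀)) _) (+-comm (bit (p₁ ∧ q₁)) _)
    (bit-rearrangement-antitone p₁ p₀ q₁ q₀ p↑ q↑)

module _ {A : Set} where

  length-filterᵇ : (p : A → Bool) (xs : List A) → length (filterᵇ p xs) ≡ sum (map (bit ∘ p) xs)
  length-filterᵇ p [] = refl
  length-filterᵇ p (x ∷ xs) with p x
  ... | true = cong suc (length-filterᵇ p xs)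
  ... | false = length-filterᵇ p xs

  sum-map-+ : (f g : A → ℕ) (xs : List A) →
    sum (map (λ x → f x + g x) xs) ≡ sum (map f xs) + sum (map g xs)
  sum-map-+ f g [] = refl
  sum-map-+ f g (x ∷ xs) = trans (cong (f x + g x +_) (sum-map-+ f g xs))
    (interchange (f x) (g x) (sum (map f xs)) (sum (map g xs)))

  sum-map-mono-≤ : {f g : A → ℕ} → (∀ x → f x ≤ g x) → (xs : List A) →
    sum (map f xs) ≤ sum (map g xs)
  sum-map-mono-≤ f≤g [] = z≤n
  sum-map-mono-≤ f≤g (x ∷ xs) = +-mono-≤ (f≤g x) (sum-map-mono-≤ f≤g xs)

sum-map-allVecs-suc : ∀ {n} (g : Vec Bool (suc n) → ℕ) →
  sum (map g (allVecs (suc n))) ≡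
  sum (map (g ∘ (false ∷_)) (allVecs n)) + sum (map (g ∘ (true ∷_)) (allVecs n))
sum-map-allVecs-suc {n} g = begin
  sum (map g (map (false ∷_) (allVecs n) ++ map (true ∷_) (allVecs n)))
    ≡⟨ cong sum (map-++ g (map (false ∷_) (allVecs n)) _) ⟩
  sum (map g (map (false ∷_) (allVecs n)) ++ map g (map (true ∷_) (allVecs n)))
    ≡⟨ sum-++ (map g (map (false ∷_) (allVecs n))) _ ⟩
  sum (map g (map (false ∷_) (allVecs n))) + sum (map g (map (true ∷_) (allVecs n)))
    ≡⟨ sym (cong₂ _+_ (cong sum (map-∘ (allVecs n))) (cong sum (map-∘ (allVecs n)))) ⟩
  sum (map (g ∘ (false ∷_)) (allVecs n)) + sum (map (g ∘ (true ∷_)) (allVecs n))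
    ∎
  where open ≡-Reasoning

wt≡0⇒dist≡wt : ∀ {n} (u w : Vec Bool n) → wt w ≡ 0 → dist u w ≡ wt u
wt≡0⇒dist≡wt [] [] _ = refl
wt≡0⇒dist≡wt (true ∷ u) (false ∷ w) wt≡0 = cong suc (wt≡0⇒dist≡wt u w wt≡0)
wt≡0⇒dist≡wt (false ∷ u) (false ∷ w) wt≡0 = wt≡0⇒dist≡wt u w wt≡0

dist≡0⇒≡ : ∀ {n} (u w : Vec Bool n) → dist u w ≡ 0 → u ≡ w
dist≡0⇒≡ [] [] _ = refl
dist≡0⇒≡ (true ∷ u) (true ∷ w) d≡0 = cong (true ∷_) (dist≡0⇒≡ u w d≡0)
dist≡0⇒≡ (false ∷ u) (false ∷ w) d≡0 = cong (false ∷_) (dist≡0⇒≡ u w d≡0)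

profileSum : (n : ℕ) → Vec Bool n → (ℕ → ℕ → ℕ) → ℕ
profileSum n v f = sum (map (λ w → f (wt w) (dist v w)) (allVecs n))

sumOutHead : Bool → (ℕ → ℕ → ℕ) → ℕ → ℕ → ℕ
sumOutHead false f a b = f a b + f (suc a) (suc b)
sumOutHead true f a b = f a (suc b) + f (suc a) b

sumOutHead-comm : ∀ x y f a b → sumOutHead x (sumOutHead y f) a b ≡ sumOutHead y (sumOutHead x f) a b
sumOutHead-comm false false f a b = refl
sumOutHead-comm true true f a b = refl
sumOutHead-comm false true f a b = interchange (f a (suc b)) _ _ _
sumOutHead-comm true false f a b = interchange (f a (suc b)) _ _ _

profileSum-∷ : ∀ {n} x (v : Vec Bool n) f → profileSum (suc n) (x ∷ v) f ≡ profileSum n v (sumOutHead x f)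
profileSum-∷ {n} x v f with x
... | false = trans (sum-map-allVecs-suc g) (sym (sum-map-+ (g ∘ (false ∷_)) (g ∘ (true ∷_)) (allVecs n)))
  where g = λ w → f (wt w) (dist (false ∷ v) w)
... | true = trans (sum-map-allVecs-suc g) (sym (sum-map-+ (g ∘ (false ∷_)) (g ∘ (true ∷_)) (allVecs n)))
  where g = λ w → f (wt w) (dist (true ∷ v) w)

profileSum-cong : ∀ {n} (v : Vec Bool n) {f g} → (∀ a b → f a b ≡ g a b) → profileSum n v f ≡ profileSum n v g
profileSum-cong {n} v f≡g = cong sum (map-cong (λ w → f≡g (wt w) (dist v w)) (allVecs n))

SameProfile : ∀ {n} → Vec Bool n → Vec Bool n → Set
SameProfile {n} u v = ∀ f → profileSum n u f ≡ profileSum n v f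

∷-sameProfile : ∀ {n} x (u v : Vec Bool n) → SameProfile u v → SameProfile (x ∷ u) (x ∷ v)
∷-sameProfile x u v u≈v f =
  trans (profileSum-∷ x u f) (trans (u≈v (sumOutHead x f)) (sym (profileSum-∷ x v f)))

swap-sameProfile : ∀ {n} x y (v : Vec Bool n) → SameProfile (x ∷ y ∷ v) (y ∷ x ∷ v)
swap-sameProfile x y v f = begin
  profileSum _ (x ∷ y ∷ v) f                     ≡⟨ profileSum-∷ x (y ∷ v) f ⟩
  profileSum _ (y ∷ v) (sumOutHead x f)          ≡⟨ profileSum-∷ y v (sumOutHead x f) ⟩
  profileSum _ v (sumOutHead y (sumOutHead x f)) ≡⟨ profileSum-cong v (sumOutHead-comm y x f) ⟩
  profileSum _ v (sumOutHead x (sumOutHead y f)) ≡⟨ sym (profileSum-∷ x v (sumOutHead y f)) ⟩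
  profileSum _ (x ∷ v) (sumOutHead y f)          ≡⟨ sym (profileSum-∷ y (x ∷ v) f) ⟩
  profileSum _ (y ∷ x ∷ v) f                     ∎
  where open ≡-Reasoning

wt≡suc⇒sameProfile-true∷ : ∀ {n} (v : Vec Bool (suc n)) {k} → wt v ≡ suc k →
  ∃[ r ] wt r ≡ k × SameProfile v (true ∷ r)
wt≡suc⇒sameProfile-true∷ (true ∷ r) wt≡ = r , suc-injective wt≡ , λ f → refl
wt≡suc⇒sameProfile-true∷ {zero} (false ∷ []) ()
wt≡suc⇒sameProfile-true∷ {suc n} (false ∷ v) wt≡ with wt≡suc⇒sameProfile-true∷ v wt≡
... | r , wt-r , v≈ = false ∷ r , wt-r ,
  λ f → trans (∷-sameProfile false v (true ∷ r) v≈ f) (swap-sameProfile false true r f)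

wt≡⇒sameProfile : ∀ {n} (u v : Vec Bool n) → wt u ≡ wt v → SameProfile u v
true∷-false∷-sameProfile : ∀ {n} (u v : Vec Bool n) → suc (wt u) ≡ wt v → SameProfile (true ∷ u) (false ∷ v)

wt≡⇒sameProfile [] [] _ f = refl
wt≡⇒sameProfile (true ∷ u) (true ∷ v) wt≡ = ∷-sameProfile true u v (wt≡⇒sameProfile u v (suc-injective wt≡))
wt≡⇒sameProfile (false ∷ u) (false ∷ v) wt≡ = ∷-sameProfile false u v (wt≡⇒sameProfile u v wt≡)
wt≡⇒sameProfile (true ∷ u) (false ∷ v) wt≡ = true∷-false∷-sameProfile u v wt≡
wt≡⇒sameProfile (false ∷ u) (true ∷ v) wt≡ f = sym (true∷-false∷-sameProfile v u (sym wt≡) f)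

true∷-false∷-sameProfile {zero} [] [] ()
true∷-false∷-sameProfile {suc n} u v wt≡ f =
  let r , wt-r , v≈ = wt≡suc⇒sameProfile-true∷ v (sym wt≡) in begin
  profileSum _ (true ∷ u) f          ≡⟨ ∷-sameProfile true u (false ∷ r) (wt≡⇒sameProfile u (false ∷ r) (sym wt-r)) f ⟩
  profileSum _ (true ∷ false ∷ r) f  ≡⟨ swap-sameProfile true false r f ⟩
  profileSum _ (false ∷ true ∷ r) f  ≡⟨ sym (∷-sameProfile false v (true ∷ r) v≈ f) ⟩
  profileSum _ (false ∷ v) f         ∎
  where open ≡-Reasoning

neighbourIndicator : ℕ → ℕ → ℕ → ℕ
neighbourIndicator d' a b = bit (inRange d' a ∧ inRange d' b)

deg≡profileSum : ∀ n d (v : Vec Bool n) → deg n d v ≡ profileSum n v (neighbourIndicator (d ∸ 1))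
deg≡profileSum n d v = length-filterᵇ _ (allVecs n)

inRange-suc : ∀ {d' a} → a < d' → T (inRange d' (suc a))
inRange-suc = <⇒<ᵇ

inRange-antitone : ∀ d' a → T (inRange d' (suc (suc a))) → T (inRange d' (suc a))
inRange-antitone d' a = <⇒<ᵇ ∘ <⇒≤ ∘ <ᵇ⇒< (suc a) d'

-- χ = inRange d' rises only at 0 and falls only at d'; the exceptions rule out {a, b} = {0, d'}.
inRange-similarlyOrdered : ∀ d' a b → (a ≡ 0 → b < d') → (b ≡ 0 → a < d') →
  let χ = inRange d' in
  (T (χ (suc a)) → T (χ a)) × (T (χ (suc b)) → T (χ b)) ⊎ (T (χ a) → T (χ (suc a))) × (T (χ b) → T (χ (suc b)))
inRange-similarlyOrdered d' zero b b<d' _ = inj₂ ((λ ()) , λ _ → inRange-suc (b<d' refl))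
inRange-similarlyOrdered d' (suc a) zero _ a<d' = inj₂ ((λ _ → inRange-suc (a<d' refl)) , λ ())
inRange-similarlyOrdered d' (suc a) (suc b) _ _ = inj₁ (inRange-antitone d' a , inRange-antitone d' b)

sumOutHead-true≤false : ∀ d' a b → (a ≡ 0 → b < d') → (b ≡ 0 → a < d') →
  sumOutHead true (neighbourIndicator d') a b ≤ sumOutHead false (neighbourIndicator d') a b
sumOutHead-true≤false d' a b a≡0⇒ b≡0⇒ =
  bit-rearrangement (χ a) (χ (suc a)) (χ b) (χ (suc b)) (inRange-similarlyOrdered d' a b a≡0⇒ b≡0⇒)
  where χ = inRange d'

profileSum-true∷≤false∷ : ∀ {n} d' (r : Vec Bool n) → wt r < d' →
  profileSum (suc n) (true ∷ r) (neighbourIndicator d') ≤ profileSum (suc n) (false ∷ r) (neighbourIndicator d')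
profileSum-true∷≤false∷ {n} d' r wt<d' = begin
  profileSum (suc n) (true ∷ r) I     ≡⟨ profileSum-∷ true r I ⟩
  profileSum n r (sumOutHead true I)  ≤⟨ sum-map-mono-≤ pointwise (allVecs n) ⟩
  profileSum n r (sumOutHead false I) ≡⟨ sym (profileSum-∷ false r I) ⟩
  profileSum (suc n) (false ∷ r) I    ∎
  where
  open ≤-Reasoning
  I = neighbourIndicator d'
  pointwise : ∀ w → sumOutHead true I (wt w) (dist r w) ≤ sumOutHead false I (wt w) (dist r w)
  pointwise w = sumOutHead-true≤false d' (wt w) (dist r w)
    (λ wt≡0 → subst (_< d') (sym (wt≡0⇒dist≡wt r w wt≡0)) wt<d')
    (λ dist≡0 → subst (λ x → wt x < d') (dist≡0⇒≡ r w dist≡0) wt<d')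

profileSum-decrease : ∀ {n} d' (u : Vec Bool n) {k} → wt u ≡ suc k → k < d' →
  ∃[ u' ] wt u' ≡ k × profileSum n u (neighbourIndicator d') ≤ profileSum n u' (neighbourIndicator d')
profileSum-decrease {zero} d' [] ()
profileSum-decrease {suc n} d' u {k} wt≡ k<d' =
  let r , wt-r , u≈ = wt≡suc⇒sameProfile-true∷ u wt≡ in
  false ∷ r , wt-r ,
  ≤-trans (≤-reflexive (u≈ (neighbourIndicator d'))) (profileSum-true∷≤false∷ d' r (subst (_< d') (sym wt-r) k<d'))

profileSum-antitone : ∀ {n} d' t (u v : Vec Bool n) → wt u ≡ t + wt v → t + wt v ≤ d' →
  profileSum n u (neighbourIndicator d') ≤ profileSum n v (neighbourIndicator d')
profileSum-antitone d' zero u v wt≡ _ = ≤-reflexive (wt≡⇒sameProfile u v wt≡ (neighbourIndicator d'))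
profileSum-antitone d' (suc t) u v wt≡ ≤d' =
  let u' , wt-u' , u≤u' = profileSum-decrease d' u wt≡ ≤d' in
  ≤-trans u≤u' (profileSum-antitone d' t u' v wt-u' (<⇒≤ ≤d'))

lemma10 : (n d : ℕ) → 1 ≤ n → 1 ≤ d → d ≤ n → (u v : Vec Bool n) → IsVertex n d u → IsVertex n d v → wt v ≤ wt u → deg n d u ≤ deg n d v
lemma10 n d _ _ _ u v (_ , wt-u≤d') _ wt-v≤wt-u = begin
  deg n d u                                  ≡⟨ deg≡profileSum n d u ⟩
  profileSum n u (neighbourIndicator (d ∸ 1)) ≤⟨ profileSum-antitone (d ∸ 1) (wt u ∸ wt v) u v (sym wt≡) ≤d' ⟩
  profileSum n v (neighbourIndicator (d ∸ 1)) ≡⟨ sym (deg≡profileSum n d v) ⟩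
  deg n d v                                  ∎
  where
  open ≤-Reasoning
  wt≡ : wt u ∸ wt v + wt v ≡ wt u
  wt≡ = m∸n+n≡m wt-v≤wt-u
  ≤d' : wt u ∸ wt v + wt v ≤ d ∸ 1
  ≤d' = subst (_≤ d ∸ 1) (sym wt≡) wt-u≤d'
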